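{- If an Eulerian orientation $\tau$ of $\Lambda_n$ has no monochromatic cross (neither a green cross nor a red cross), then $\tau$ has a fault line (horizontal or vertical).
   Context: $\Lambda_n$: internal vertices $(i,j)\in\mathbb{Z}^2$, $1\le i,j\le n$, nearest-neighbour edges between them, plus edges from each boundary internal vertex to its lattice neighbours outside the square (free boundary). An Eulerian orientation orients every edge so that each internal vertex has two incoming and two outgoing edges. Let $\tau_{\mathrm{G}}$ be the orientation where at internal $(i,j)$ with $i+j$ even both horizontal edges point in and both vertical point out, and with $i+j$ odd the reverse. An edge of $\tau$ is green if oriented as in $\tau_{\mathrm{G}}$, red otherwise. A horizontal (vertical) green/red bridge is a simple monochromatic path from a horizontal edge on the left boundary to one on the right boundary (resp. from a vertical edge on the top boundary to one on the bottom); a green (red) cross is the simultaneous presence of a horizontal and a vertical green (red) bridge. Let $L_n$ be the graph whose vertices are the points of $\mathbb{Z}^2+(\tfrac12,\tfrac12)$ in the square region covered by $\Lambda_n$ (i.e. $(x+\tfrac12,y+\tfrac12)$, $0\le x,y\le n$), with edges joining points at displacement $(\pm1,\pm1)$; each such diagonal edge $e$ passes through exactly one internal vertex $v_e$ of $\Lambda_n$. For a state $\tau$, $L_\tau$ is the set of $L_n$-edges $e$ such that the four edges at $v_e$ are two green and two red and $e$ separates the two green edges from the two red edges. $\tau$ has a horizontal (vertical) fault line if there is a self-avoiding path of $L_\tau$-edges from an $L_n$-vertex on the left (top) boundary of $L_n$ to an $L_n$-vertex on the right (bottom) boundary of $L_n$. -}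

module Defs where

open import Data.Nat using (ℕ; zero; suc; _+_; _≤_; _<_)
open import Data.Bool using (Bool; true; false; not; if_then_else_)
open import Data.Product using (_×_; _,_; ∃-syntax)
open import Data.Sum using (_⊎_)
open import Data.Maybe using (just)
open import Data.List using (List; head; last)
open import Data.List.Relation.Unary.All using (All)
open import Data.List.Relation.Unary.Linked using (Linked)
open import Data.List.Relation.Unary.Unique.Propositional using (Unique)
open import Relation.Binary.PropositionalEquality using (_≡_; _≢_)
open import Relation.Nullary using (¬_)

-- Internal vertices: (i , j) with 1 ≤ i , j ≤ n  (i = column / x, j = row / y,
-- y increasing upwards, so "top" = row n, "bottom" = row 1).
-- Horizontal edge  h i j  (0 ≤ i ≤ n, 1 ≤ j ≤ n) joins (i , j) and (i+1 , j);
--   h 0 j and h n j are the boundary edges on the left / right.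
-- Vertical edge    v i j  (1 ≤ i ≤ n, 0 ≤ j ≤ n) joins (i , j) and (i , j+1);
--   v i 0 and v i n are the boundary edges on the bottom / top.
-- An orientation assigns a Bool to each edge:
--   hor i j = true  means  h i j points right (from (i,j) to (i+1,j)),
--   ver i j = true  means  v i j points up    (from (i,j) to (i,j+1)).
-- Values outside the index ranges above are never consulted.

record Orientation : Set where
  field
    hor : ℕ → ℕ → Bool
    ver : ℕ → ℕ → Bool
open Orientation public

b2n : Bool → ℕ
b2n true  = 1
b2n false = 0

-- number of incoming edges at the internal vertex (suc a , suc b)
inDeg : Orientation → ℕ → ℕ → ℕ
inDeg τ a b =
    b2n (hor τ a (suc b))                    -- west edge points right = in
  + b2n (not (hor τ (suc a) (suc b)))        -- east edge points left = in
  + b2n (ver τ (suc a) b)                    -- south edge points up = in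
  + b2n (not (ver τ (suc a) (suc b)))        -- north edge points down = in

-- Eulerian: every internal vertex has exactly two incoming edges
-- (hence also exactly two outgoing ones, as its degree is 4).
Eulerian : ℕ → Orientation → Set
Eulerian n τ = ∀ a b → a < n → b < n → inDeg τ a b ≡ 2

odd : ℕ → Bool
odd zero    = false
odd (suc k) = not (odd k)

-- The reference orientation τ_G: at internal (i,j) with i+j even both
-- horizontal edges point in and both vertical edges point out; reverse
-- for i+j odd.
τG : Orientation
τG = record { hor = λ i j → odd (i + j) ; ver = λ i j → not (odd (i + j)) }

data Colour : Set where
  green red : Colour

agree : Bool → Bool → Colour
agree true  true  = green
agree false false = green
agree true  false = red
agree false true  = red

colH : Orientation → ℕ → ℕ → Colour
colH τ i j = agree (hor τ i j) (hor τG i j)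

colV : Orientation → ℕ → ℕ → Colour
colV τ i j = agree (ver τ i j) (ver τG i j)

Vertex : Set
Vertex = ℕ × ℕ

Internal : ℕ → Vertex → Set
Internal n (i , j) = (1 ≤ i × i ≤ n) × (1 ≤ j × j ≤ n)

data Step (τ : Orientation) (c : Colour) : Vertex → Vertex → Set where
  right : ∀ {i j} → colH τ i j ≡ c → Step τ c (i , j) (suc i , j)
  left  : ∀ {i j} → colH τ i j ≡ c → Step τ c (suc i , j) (i , j)
  up    : ∀ {i j} → colV τ i j ≡ c → Step τ c (i , j) (i , suc j)
  down  : ∀ {i j} → colV τ i j ≡ c → Step τ c (i , suc j) (i , j)

-- simple path of colour c through the internal vertices ps
-- (the external endpoints of the boundary edges are distinct from
-- each other and from all internal vertices)
MonoPath : ℕ → Orientation → Colour → List Vertex → Set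
MonoPath n τ c ps = All (Internal n) ps × Linked (Step τ c) ps × Unique ps

HBridge : ℕ → Orientation → Colour → Set
HBridge n τ c = ∃[ ps ] ∃[ j ] ∃[ j' ]
  ( MonoPath n τ c ps
  × head ps ≡ just (1 , j) × colH τ 0 j ≡ c
  × last ps ≡ just (n , j') × colH τ n j' ≡ c )

VBridge : ℕ → Orientation → Colour → Set
VBridge n τ c = ∃[ ps ] ∃[ i ] ∃[ i' ]
  ( MonoPath n τ c ps
  × head ps ≡ just (i , n) × colV τ i n ≡ c
  × last ps ≡ just (i' , 1) × colV τ i' 0 ≡ c )

Cross : ℕ → Orientation → Colour → Set
Cross n τ c = HBridge n τ c × VBridge n τ c

-- L-vertex (x , y), 0 ≤ x , y ≤ n, stands for the point (x+½ , y+½).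
-- For an internal vertex (suc a , suc b) (a , b < n):
--   its "NE" diagonal joins (a , b) and (suc a , suc b); it separates
--   the north and west edges from the south and east edges;
--   its "NW" diagonal joins (suc a , b) and (a , suc b); it separates
--   the north and east edges from the south and west edges.

module _ (τ : Orientation) (a b : ℕ) where
  cN cS cE cW : Colour
  cN = colV τ (suc a) (suc b)
  cS = colV τ (suc a) b
  cE = colH τ (suc a) (suc b)
  cW = colH τ a (suc b)

  NEinL : Set
  NEinL = cN ≡ cW × cS ≡ cE × cN ≢ cS

  NWinL : Set
  NWinL = cN ≡ cE × cS ≡ cW × cN ≢ cS

data LStep (n : ℕ) (τ : Orientation) : Vertex → Vertex → Set where
  ne  : ∀ {a b} → a < n → b < n → NEinL τ a b → LStep n τ (a , b) (suc a , suc b)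
  ne' : ∀ {a b} → a < n → b < n → NEinL τ a b → LStep n τ (suc a , suc b) (a , b)
  nw  : ∀ {a b} → a < n → b < n → NWinL τ a b → LStep n τ (suc a , b) (a , suc b)
  nw' : ∀ {a b} → a < n → b < n → NWinL τ a b → LStep n τ (a , suc b) (suc a , b)

LVertex : ℕ → Vertex → Set
LVertex n (x , y) = x ≤ n × y ≤ n

LPath : ℕ → Orientation → List Vertex → Set
LPath n τ qs = All (LVertex n) qs × Linked (LStep n τ) qs × Unique qs

HFault : ℕ → Orientation → Set
HFault n τ = ∃[ qs ] ∃[ y ] ∃[ y' ]
  ( LPath n τ qs × head qs ≡ just (0 , y) × last qs ≡ just (n , y') )

VFault : ℕ → Orientation → Set
VFault n τ = ∃[ qs ] ∃[ x ] ∃[ x' ]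
  ( LPath n τ qs × head qs ≡ just (x , n) × last qs ≡ just (x' , 0) )

module Submission where

-- Let R be the set of L-vertices joined to the right side of L_n by a path of L_τ-edges, and
-- B the set of those joined to the bottom side.  If R meets the left side, or B the top side,
-- erasing the loops of the joining walk gives a fault line.
--
-- Otherwise look at the edges of Λ_n separating R from its complement.  At an internal vertex
-- an Eulerian orientation has either four edges of one colour, or two green and two red edges
-- cut apart by an L_τ-diagonal, across which R is constant; so for each colour the separating
-- edges of that colour have even degree at every internal vertex.  R contains the right side
-- but not the left one, so an odd number of top edges separate R, and for some colour c an
-- odd number of them have colour c.  By the handshake lemma the set of vertices joined to the
-- bottom side by c-coloured separating edges must then meet one of those top edges, which
-- gives a vertical c-bridge.  In the same way B gives a horizontal c'-bridge.  If c = c' this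
-- is a monochromatic cross.  If c ≠ c', the c'-coloured edges separating B form a mod 2
-- cocycle; its potential is 1 on the top row of L_n and 0 on the bottom row, and it does not
-- change along a c-coloured path, contradicting the vertical c-bridge.

open import Defs
open import Algebra.Bundles using (CommutativeRing; CommutativeMonoid)
open import Data.Bool using (Bool; true; false; not; _∧_; _xor_) renaming (_≟_ to _≟ᵇ_)
open import Data.Bool.Properties
  using (¬-not; xor-same; xor-assoc; xor-comm; xor-identityʳ; ∧-distribˡ-xor; ∧-zeroʳ; xor-∧-commutativeRing)
open import Data.Empty using (⊥-elim)
open import Data.List using (List; []; _∷_; _++_; head; last; length; map; upTo; cartesianProduct)
open import Data.List.Membership.Propositional using (_∈_; _─_; find; lose)
open import Data.List.Membership.Propositional.Properties
  using (∈-++⁻; ∈-++⁺ˡ; ∈-++⁺ʳ; ∈-cartesianProduct⁺; ∈-upTo⁺)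
open import Data.List.Properties using (length-removeAt′; head-map; last-map)
open import Data.List.Relation.Binary.Subset.Propositional using (_⊆_)
open import Data.List.Relation.Unary.All as All using (All; []; _∷_)
import Data.List.Relation.Unary.All.Properties as All
open import Data.List.Relation.Unary.AllPairs using ([]; _∷_)
open import Data.List.Relation.Unary.Any using (here; there; index; any?)
open import Data.List.Relation.Unary.Linked as Linked using (Linked; []; [-]; _∷_)
import Data.List.Relation.Unary.Linked.Properties as Linked
open import Data.List.Relation.Unary.Unique.Propositional using (Unique)
open import Data.Maybe as Maybe using (just)
open import Data.Nat using (ℕ; zero; suc; _+_; _∸_; _≤_; _<_; _≤?_; _<?_; z≤n; s≤s) renaming (_≟_ to _≟ℕ_)
open import Data.Nat.Properties using (+-suc; ≤-refl; <⇒≤; m<n⇒m<1+n; n<1+n; anyUpTo?)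
open import Data.Product using (Σ; ∃-syntax; _×_; _,_; proj₁; proj₂; map₂)
open import Data.Product.Properties using (≡-dec)
open import Data.Sum using (_⊎_; inj₁; inj₂; [_,_]′)
open import Function using (_∘_)
open import Level using (0ℓ)
open import Relation.Binary.Core using (Rel)
open import Relation.Binary.Definitions using (DecidableEquality)
open import Relation.Binary.PropositionalEquality
  using (_≡_; _≢_; refl; sym; trans; subst; cong; cong₂; ≢-sym; module ≡-Reasoning)
open import Relation.Nullary using (Dec; yes; no; does; ¬_; ¬?)
open import Relation.Nullary.Decidable using (_×-dec_; dec-true; dec-false)
open import Relation.Unary using (Pred; Decidable)
open import Algebra.Properties.CommutativeSemigroup
  (CommutativeMonoid.commutativeSemigroup (CommutativeRing.+-commutativeMonoid xor-∧-commutativeRing))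
  using () renaming (interchange to xor-interchange)

module _ {A : Set} where

  ∈-─ : ∀ {x y : A} {ys} (x∈ys : x ∈ ys) → y ∈ ys → y ≢ x → y ∈ ys ─ x∈ys
  ∈-─ (here refl) (here refl) y≢x = ⊥-elim (y≢x refl)
  ∈-─ (here _)    (there y∈ys) _   = y∈ys
  ∈-─ (there _)   (here refl)  _   = here refl
  ∈-─ (there x∈ys) (there y∈ys) y≢x = there (∈-─ x∈ys y∈ys y≢x)

  Unique∧⊆⇒length≤ : ∀ {xs ys : List A} → Unique xs → xs ⊆ ys → length xs ≤ length ys
  Unique∧⊆⇒length≤ {[]}     _             _   = z≤n
  Unique∧⊆⇒length≤ {x ∷ xs} {ys} (x∉xs ∷ u) sub =
    subst (suc (length xs) ≤_) (sym (length-removeAt′ ys (index x∈ys)))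
      (s≤s (Unique∧⊆⇒length≤ u λ y∈xs →
        ∈-─ x∈ys (sub (there y∈xs)) (≢-sym (All.lookup x∉xs y∈xs))))
    where
      x∈ys : x ∈ ys
      x∈ys = sub (here refl)

module LoopErasure {A : Set} (_≟_ : DecidableEquality A) (R : Rel A 0ℓ) (P : Pred A 0ℓ) where

  SimpleWalk : List A → Set
  SimpleWalk xs = All P xs × Linked R xs × Unique xs

  suffixFrom : ∀ {x} ys → x ∈ ys → List A
  suffixFrom (y ∷ ys) (here _)     = y ∷ ys
  suffixFrom (y ∷ ys) (there x∈ys) = suffixFrom ys x∈ys

  suffixFrom-head : ∀ {x} ys (x∈ys : x ∈ ys) → head (suffixFrom ys x∈ys) ≡ just x
  suffixFrom-head (y ∷ ys) (here refl)  = refl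
  suffixFrom-head (y ∷ ys) (there x∈ys) = suffixFrom-head ys x∈ys

  suffixFrom-last : ∀ {x} ys (x∈ys : x ∈ ys) → last (suffixFrom ys x∈ys) ≡ last ys
  suffixFrom-last (y ∷ ys)     (here _)     = refl
  suffixFrom-last (y ∷ z ∷ ys) (there x∈ys) = suffixFrom-last (z ∷ ys) x∈ys

  suffixFrom-simple : ∀ {x} ys (x∈ys : x ∈ ys) → SimpleWalk ys → SimpleWalk (suffixFrom ys x∈ys)
  suffixFrom-simple (y ∷ ys) (here _)     w = w
  suffixFrom-simple (y ∷ ys) (there x∈ys) (_ ∷ p , r , _ ∷ u) =
    suffixFrom-simple ys x∈ys (p , Linked.tail r , u)

  loopErase : ∀ xs → All P xs → Linked R xs →
    ∃[ ys ] SimpleWalk ys × head ys ≡ head xs × last ys ≡ last xs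
  loopErase []           _        _        = [] , ([] , [] , []) , refl , refl
  loopErase (x ∷ [])     (p ∷ []) _        = x ∷ [] , (p ∷ [] , [-] , [] ∷ []) , refl , refl
  loopErase (x ∷ y ∷ xs) (p ∷ ps) (r ∷ rs) with loopErase (y ∷ xs) ps rs
  ... | zs , s , h , l with any? (x ≟_) zs
  ...   | yes x∈zs = suffixFrom zs x∈zs , suffixFrom-simple zs x∈zs s , suffixFrom-head zs x∈zs ,
                     trans (suffixFrom-last zs x∈zs) l
  loopErase (x ∷ y ∷ xs) (p ∷ ps) (r ∷ rs) | z ∷ zs , (ps' , rs' , u) , refl , l | no x∉zs =
    x ∷ z ∷ zs , (p ∷ ps' , r ∷ rs' , All.¬Any⇒All¬ (z ∷ zs) x∉zs ∷ u) , refl , l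

  simplify : ∀ {x y} xs → All P xs → Linked R xs → head xs ≡ just x → last xs ≡ just y →
    ∃[ ys ] SimpleWalk ys × head ys ≡ just x × last ys ≡ just y
  simplify xs ps rs h l = let ys , s , h' , l' = loopErase xs ps rs in ys , s , trans h' h , trans l' l

keepIf : ∀ {A P : Set} → Dec P → A → List A
keepIf (yes _) x = x ∷ []
keepIf (no _)  _ = []

∈-keepIf⁻ : ∀ {A P : Set} {d : Dec P} {x y : A} → y ∈ keepIf d x → P × y ≡ x
∈-keepIf⁻ {d = yes p} (here refl) = p , refl

∈-keepIf⁺ : ∀ {A P : Set} {d : Dec P} {x : A} → P → x ∈ keepIf d x
∈-keepIf⁺ {d = yes _} _ = here refl
∈-keepIf⁺ {d = no ¬p} p = ⊥-elim (¬p p)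

record Walk {A : Set} (Step : Rel A 0ℓ) (In Target : Pred A 0ℓ) (v : A) : Set where
  field
    rest    : List A
    linked  : Linked Step (v ∷ rest)
    inside  : All In (v ∷ rest)
    end     : A
    ends    : last (v ∷ rest) ≡ just end
    reached : Target end

module Reachability {A : Set} (_≟_ : DecidableEquality A)
  (Step : Rel A 0ℓ) (next : A → List A)
  (next-sound : ∀ {v w} → w ∈ next v → Step v w) (next-complete : ∀ {v w} → Step v w → w ∈ next v)
  {In : Pred A 0ℓ} (In? : Decidable In) {Target : Pred A 0ℓ} (Target? : Decidable Target)
  (universe : List A) (In⊆universe : ∀ {v} → In v → v ∈ universe) where

  data Reach : ℕ → A → Set where
    arrived : ∀ {k v} → In v → Target v → Reach k v
    advance : ∀ {k v w} → In v → Step v w → Reach k w → Reach (suc k) v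

  reach? : ∀ k v → Dec (Reach k v)
  reach? k v with In? v | Target? v
  ... | no ¬inside | _ = no λ { (arrived i _) → ¬inside i ; (advance i _ _) → ¬inside i }
  ... | yes inside | yes t = yes (arrived inside t)
  reach? zero    v | yes inside | no ¬t = no λ { (arrived _ t) → ¬t t }
  reach? (suc k) v | yes inside | no ¬t with any? (reach? k) (next v)
  ... | yes r = let w , w∈ , rw = find r in yes (advance inside (next-sound w∈) rw)
  ... | no ¬r = no λ { (arrived _ t) → ¬t t ; (advance _ e rw) → ¬r (lose (next-complete e) rw) }

  walk : ∀ {k v} → Reach k v → Σ (Walk Step In Target v) λ ω → length (Walk.rest ω) ≤ k
  walk (arrived i t) = record { rest = [] ; linked = [-] ; inside = i ∷ [] ; ends = refl ; reached = t } , z≤n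
  walk (advance i e r) with walk r
  ... | ω , ≤k =
    record { rest = _ ∷ rest ; linked = e ∷ linked ; inside = i ∷ inside ; ends = ends ; reached = reached } ,
    s≤s ≤k
    where open Walk ω

  unwalk : ∀ {k v t} xs → Linked Step (v ∷ xs) → All In (v ∷ xs) → last (v ∷ xs) ≡ just t → Target t →
           length xs ≤ k → Reach k v
  unwalk []       _       (i ∷ [])    refl t _         = arrived i t
  unwalk (w ∷ xs) (e ∷ l) (i ∷ insd)  lt   t (s≤s ≤k)  = advance i e (unwalk xs l insd lt t ≤k)

  open LoopErasure _≟_ Step In

  -- A loop-erased walk inside In has no more vertices than the universe.
  shorten : ∀ {k v} → Reach k v → Reach (length universe) v
  shorten r with walk r
  ... | ω , _ with simplify (_ ∷ rest) inside linked refl ends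
    where open Walk ω
  ... | w ∷ ws , (insd , l , u) , refl , lt =
    unwalk ws l insd lt (Walk.reached ω)
      (<⇒≤ (Unique∧⊆⇒length≤ u λ x∈ → In⊆universe (All.lookup insd x∈)))

  reaches : A → Bool
  reaches v = does (reach? (length universe) v)

  reaches-target : ∀ {v} → In v → Target v → reaches v ≡ true
  reaches-target i t = dec-true (reach? _ _) (arrived i t)

  reaches-backward : ∀ {v w} → In v → Step v w → reaches w ≡ true → reaches v ≡ true
  reaches-backward {w = w} i e r with reach? (length universe) w
  ... | yes rw = dec-true (reach? _ _) (shorten (advance i e rw))

  reaches⇒walk : ∀ {v} → reaches v ≡ true → Walk Step In Target v
  reaches⇒walk {v} r with reach? (length universe) v
  ... | yes rv = proj₁ (walk rv)

open ≡-Reasoning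

xor-cancel-middle : ∀ a b c → (a xor b) xor (b xor c) ≡ a xor c
xor-cancel-middle a b c = begin
  (a xor b) xor (b xor c)  ≡⟨ xor-assoc a b (b xor c) ⟩
  a xor (b xor (b xor c))  ≡⟨ cong (a xor_) (sym (xor-assoc b b c)) ⟩
  a xor ((b xor b) xor c)  ≡⟨ cong (λ x → a xor (x xor c)) (xor-same b) ⟩
  a xor c                  ∎

xor≡false⇒≡ : ∀ {a b} → a xor b ≡ false → a ≡ b
xor≡false⇒≡ {false} {false} _ = refl
xor≡false⇒≡ {true}  {true}  _ = refl

true≢false : true ≢ false
true≢false ()

∧≡true⇒ : ∀ {x y} → x ∧ y ≡ true → x ≡ true × y ≡ true
∧≡true⇒ {true} {true} _ = refl , refl

true⇔true⇒≡ : ∀ {x y} → (x ≡ true → y ≡ true) → (y ≡ true → x ≡ true) → x ≡ y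
true⇔true⇒≡ {false} {false} _ _ = refl
true⇔true⇒≡ {false} {true}  _ y⇒x = y⇒x refl
true⇔true⇒≡ {true}  x⇒y _ = sym (x⇒y refl)

∧-cong-guarded : ∀ {u u'} h → (h ≡ true → u ≡ u') → u ∧ h ≡ u' ∧ h
∧-cong-guarded true  u≡u' = cong (_∧ true) (u≡u' refl)
∧-cong-guarded false _    = trans (∧-zeroʳ _) (sym (∧-zeroʳ _))

parity : ℕ → (ℕ → Bool) → Bool
parity zero    f = false
parity (suc m) f = parity m f xor f m

parity-cong : ∀ m {f g} → (∀ i → i < m → f i ≡ g i) → parity m f ≡ parity m g
parity-cong zero    _   = refl
parity-cong (suc m) f≗g = cong₂ _xor_ (parity-cong m λ i i<m → f≗g i (m<n⇒m<1+n i<m)) (f≗g m (n<1+n m))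

parity-false : ∀ m {f} → (∀ i → i < m → f i ≡ false) → parity m f ≡ false
parity-false zero    _    = refl
parity-false (suc m) f≗0 =
  cong₂ _xor_ (parity-false m λ i i<m → f≗0 i (m<n⇒m<1+n i<m)) (f≗0 m (n<1+n m))

parity-xor : ∀ m f g → parity m (λ i → f i xor g i) ≡ parity m f xor parity m g
parity-xor zero    f g = refl
parity-xor (suc m) f g =
  trans (cong (_xor (f m xor g m)) (parity-xor m f g))
        (xor-interchange (parity m f) (parity m g) (f m) (g m))

parity-swap : ∀ m k (F : ℕ → ℕ → Bool) →
  parity m (λ a → parity k (F a)) ≡ parity k (λ b → parity m (λ a → F a b))
parity-swap zero    k F = sym (parity-false k λ _ _ → refl)
parity-swap (suc m) k F =
  trans (cong (_xor parity k (F m)) (parity-swap m k F)) (sym (parity-xor k _ (F m)))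

parity-telescope : ∀ m (k : ℕ → Bool) → parity m (λ i → k i xor k (suc i)) ≡ k 0 xor k m
parity-telescope zero    k = sym (xor-same (k 0))
parity-telescope (suc m) k =
  trans (cong (_xor (k m xor k (suc m))) (parity-telescope m k)) (xor-cancel-middle (k 0) (k m) (k (suc m)))

parity-true⇒∃ : ∀ m f → parity m f ≡ true → ∃[ i ] i < m × f i ≡ true
parity-true⇒∃ (suc m) f odd with f m in fm
... | true  = m , n<1+n m , fm
... | false =
  let i , i<m , fi = parity-true⇒∃ m f (trans (sym (xor-identityʳ _)) odd) in i , m<n⇒m<1+n i<m , fi

bounded-search : (f : ℕ → Bool) (n : ℕ) → (∃[ i ] i ≤ n × f i ≡ true) ⊎ (∀ i → i ≤ n → f i ≡ false)
bounded-search f n with anyUpTo? (λ i → f i ≟ᵇ true) (suc n)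
... | yes (i , s≤s i≤n , fi) = inj₁ (i , i≤n , fi)
... | no none                = inj₂ λ i i≤n → ¬-not λ fi → none (i , s≤s i≤n , fi)

line-flux : ∀ m (u h : ℕ → Bool) → (∀ a → a < m → h (suc a) ≡ true → u a ≡ u (suc a)) →
  parity (suc m) (λ a → u a ∧ (h a xor h (suc a))) ≡ (u 0 ∧ h 0) xor (u m ∧ h (suc m))
line-flux zero    u h _     = ∧-distribˡ-xor (u 0) (h 0) (h 1)
line-flux (suc m) u h const = begin
    parity (suc m) (λ a → u a ∧ (h a xor h (suc a))) xor (u (suc m) ∧ (h (suc m) xor h (2+ m)))
  ≡⟨ cong₂ _xor_ (line-flux m u h λ a a<m → const a (m<n⇒m<1+n a<m)) (∧-distribˡ-xor (u (suc m)) _ _) ⟩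
    ((u 0 ∧ h 0) xor (u m ∧ h (suc m))) xor ((u (suc m) ∧ h (suc m)) xor (u (suc m) ∧ h (2+ m)))
  ≡⟨ cong (λ x → ((u 0 ∧ h 0) xor x) xor ((u (suc m) ∧ h (suc m)) xor (u (suc m) ∧ h (2+ m))))
          (∧-cong-guarded (h (suc m)) (const m (n<1+n m))) ⟩
    ((u 0 ∧ h 0) xor (u (suc m) ∧ h (suc m))) xor ((u (suc m) ∧ h (suc m)) xor (u (suc m) ∧ h (2+ m)))
  ≡⟨ xor-cancel-middle (u 0 ∧ h 0) (u (suc m) ∧ h (suc m)) (u (suc m) ∧ h (2+ m)) ⟩
    (u 0 ∧ h 0) xor (u (suc m) ∧ h (2+ m))
  ∎
  where 2+ : ℕ → ℕ
        2+ k = suc (suc k)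

-- The grid has vertices (a , b) with a , b ≤ m.  fH a b is the edge reaching (a , b) from the
-- left and fV a b the edge reaching it from below, so that fH 0 b, fH (suc m) b, fV a 0 and
-- fV a (suc m) are the edges leaving the grid.
module Grid (m : ℕ) (fH fV : ℕ → ℕ → Bool) where

  n : ℕ
  n = suc m

  EvenDegrees : Set
  EvenDegrees = ∀ a b → a < n → b < n → (fH a b xor fH (suc a) b) xor (fV a b xor fV a (suc b)) ≡ false

  ConstantAlongEdges : (ℕ → ℕ → Bool) → Set
  ConstantAlongEdges u = (∀ a b → a < m → b < n → fH (suc a) b ≡ true → u a b ≡ u (suc a) b)
                       × (∀ a b → a < n → b < m → fV a (suc b) ≡ true → u a b ≡ u a (suc b))

  leftFlux rightFlux bottomFlux topFlux : (ℕ → ℕ → Bool) → Bool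
  leftFlux   u = parity n λ b → u 0 b ∧ fH 0 b
  rightFlux  u = parity n λ b → u m b ∧ fH n b
  bottomFlux u = parity n λ a → u a 0 ∧ fV a 0
  topFlux    u = parity n λ a → u a m ∧ fV a n

  handshake : EvenDegrees → ∀ u → ConstantAlongEdges u →
    (leftFlux u xor rightFlux u) xor (bottomFlux u xor topFlux u) ≡ false
  handshake even u (constH , constV) = begin
      (leftFlux u xor rightFlux u) xor (bottomFlux u xor topFlux u)
    ≡⟨ sym (cong₂ _xor_ (parity-xor n (λ b → u 0 b ∧ fH 0 b) (λ b → u m b ∧ fH n b))
                        (parity-xor n (λ a → u a 0 ∧ fV a 0) (λ a → u a m ∧ fV a n))) ⟩
      parity n (λ b → (u 0 b ∧ fH 0 b) xor (u m b ∧ fH n b))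
        xor parity n (λ a → (u a 0 ∧ fV a 0) xor (u a m ∧ fV a n))
    ≡⟨ sym (cong₂ _xor_
         (parity-cong n λ b b<n → line-flux m (λ a → u a b) (λ a → fH a b) λ a a<m → constH a b a<m b<n)
         (parity-cong n λ a a<n → line-flux m (u a) (fV a) λ b b<m → constV a b a<n b<m)) ⟩
      parity n (λ b → parity n λ a → u a b ∧ horizontal a b)
        xor parity n (λ a → parity n λ b → u a b ∧ vertical a b)
    ≡⟨ cong (parity n (λ b → parity n λ a → u a b ∧ horizontal a b) xor_)
            (parity-swap n n λ a b → u a b ∧ vertical a b) ⟩
      parity n (λ b → parity n λ a → u a b ∧ horizontal a b)
        xor parity n (λ b → parity n λ a → u a b ∧ vertical a b)
    ≡⟨ sym (parity-xor n _ _) ⟩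
      parity n (λ b → parity n (λ a → u a b ∧ horizontal a b) xor parity n (λ a → u a b ∧ vertical a b))
    ≡⟨ parity-false n (λ b b<n → trans (sym (parity-xor n _ _)) (parity-false n λ a a<n → begin
         (u a b ∧ horizontal a b) xor (u a b ∧ vertical a b) ≡⟨ sym (∧-distribˡ-xor (u a b) _ _) ⟩
         u a b ∧ (horizontal a b xor vertical a b)           ≡⟨ cong (u a b ∧_) (even a b a<n b<n) ⟩
         u a b ∧ false                                        ≡⟨ ∧-zeroʳ (u a b) ⟩
         false                                                ∎)) ⟩
      false
    ∎
    where
      horizontal vertical : ℕ → ℕ → Bool
      horizontal a b = fH a b xor fH (suc a) b
      vertical   a b = fV a b xor fV a (suc b)

  -- potential x y lives on the face to the upper right of (x - 1 , y - 1); when the degrees are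
  -- even it changes exactly across the edges marked by fH and fV.
  potential : ℕ → ℕ → Bool
  potential x y = parity y (fH x)

  module _ (even : EvenDegrees) where

    bottomFlux≡topFlux : ∀ u → ConstantAlongEdges u →
      (∀ b → b < n → fH 0 b ≡ false) → (∀ b → b < n → fH n b ≡ false) → bottomFlux u ≡ topFlux u
    bottomFlux≡topFlux u const left0 right0 = xor≡false⇒≡ (begin
      bottomFlux u xor topFlux u
        ≡⟨ cong (λ x → x xor (bottomFlux u xor topFlux u)) (sym (cong₂ _xor_
             (parity-false n λ b b<n → trans (cong (u 0 b ∧_) (left0 b b<n)) (∧-zeroʳ _))
             (parity-false n λ b b<n → trans (cong (u m b ∧_) (right0 b b<n)) (∧-zeroʳ _)))) ⟩
      (leftFlux u xor rightFlux u) xor (bottomFlux u xor topFlux u)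
        ≡⟨ handshake even u const ⟩
      false ∎)

    leftFlux≡rightFlux : ∀ u → ConstantAlongEdges u →
      (∀ a → a < n → fV a 0 ≡ false) → (∀ a → a < n → fV a n ≡ false) → leftFlux u ≡ rightFlux u
    leftFlux≡rightFlux u const bottom0 top0 = xor≡false⇒≡ (begin
      leftFlux u xor rightFlux u
        ≡⟨ sym (xor-identityʳ _) ⟩
      (leftFlux u xor rightFlux u) xor false
        ≡⟨ cong ((leftFlux u xor rightFlux u) xor_) (sym (cong₂ _xor_
             (parity-false n λ a a<n → trans (cong (u a 0 ∧_) (bottom0 a a<n)) (∧-zeroʳ _))
             (parity-false n λ a a<n → trans (cong (u a m ∧_) (top0 a a<n)) (∧-zeroʳ _)))) ⟩
      (leftFlux u xor rightFlux u) xor (bottomFlux u xor topFlux u)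
        ≡⟨ handshake even u const ⟩
      false ∎)

    module _ (bottom0 : ∀ a → a < n → fV a 0 ≡ false) where

      potential-step-right : ∀ x y → x < n → y ≤ n → potential (suc x) y xor potential x y ≡ fV x y
      potential-step-right x zero    x<n _ = sym (bottom0 x x<n)
      potential-step-right x (suc y) x<n y<n = begin
          (potential (suc x) y xor fH (suc x) y) xor (potential x y xor fH x y)
        ≡⟨ xor-interchange (potential (suc x) y) (fH (suc x) y) (potential x y) (fH x y) ⟩
          (potential (suc x) y xor potential x y) xor (fH (suc x) y xor fH x y)
        ≡⟨ cong₂ _xor_ (potential-step-right x y x<n (<⇒≤ y<n)) (xor-comm (fH (suc x) y) (fH x y)) ⟩
          fV x y xor (fH x y xor fH (suc x) y)
        ≡⟨ xor-comm (fV x y) _ ⟩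
          (fH x y xor fH (suc x) y) xor fV x y
        ≡⟨ xor≡false⇒≡ (trans (xor-assoc (fH x y xor fH (suc x) y) (fV x y) (fV x (suc y))) (even x y x<n y<n)) ⟩
          fV x (suc y)
        ∎

      potential-top : (∀ a → a < n → fV a n ≡ false) → parity n (fH 0) ≡ true →
        ∀ x → x ≤ n → potential x n ≡ true
      potential-top top0 left1 zero    _   = left1
      potential-top top0 left1 (suc x) x<n = trans
        (xor≡false⇒≡ (trans (potential-step-right x n x<n ≤-refl) (top0 x x<n)))
        (potential-top top0 left1 x (<⇒≤ x<n))

  data GridStep : ℕ × ℕ → ℕ × ℕ → Set where
    right : ∀ {a b} → fH (suc a) b ≡ true → GridStep (a , b) (suc a , b)
    left  : ∀ {a b} → fH (suc a) b ≡ true → GridStep (suc a , b) (a , b)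
    up    : ∀ {a b} → fV a (suc b) ≡ true → GridStep (a , b) (a , suc b)
    down  : ∀ {a b} → fV a (suc b) ≡ true → GridStep (a , suc b) (a , b)

  InGrid : ℕ × ℕ → Set
  InGrid (a , b) = a < n × b < n

  private
    rightOf upOf leftOf belowOf neighbours : ℕ × ℕ → List (ℕ × ℕ)
    rightOf (a , b)     = keepIf (fH (suc a) b ≟ᵇ true) (suc a , b)
    upOf    (a , b)     = keepIf (fV a (suc b) ≟ᵇ true) (a , suc b)
    leftOf  (zero  , b) = []
    leftOf  (suc a , b) = keepIf (fH (suc a) b ≟ᵇ true) (a , b)
    belowOf (a , zero)  = []
    belowOf (a , suc b) = keepIf (fV a (suc b) ≟ᵇ true) (a , b)
    neighbours v = rightOf v ++ upOf v ++ leftOf v ++ belowOf v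

    rightOf-sound : ∀ {v w} → w ∈ rightOf v → GridStep v w
    rightOf-sound w∈ with ∈-keepIf⁻ w∈
    ... | e , refl = right e

    upOf-sound : ∀ {v w} → w ∈ upOf v → GridStep v w
    upOf-sound w∈ with ∈-keepIf⁻ w∈
    ... | e , refl = up e

    leftOf-sound : ∀ {v w} → w ∈ leftOf v → GridStep v w
    leftOf-sound {suc a , b} w∈ with ∈-keepIf⁻ w∈
    ... | e , refl = left e

    belowOf-sound : ∀ {v w} → w ∈ belowOf v → GridStep v w
    belowOf-sound {a , suc b} w∈ with ∈-keepIf⁻ w∈
    ... | e , refl = down e

    neighbours-sound : ∀ {v w} → w ∈ neighbours v → GridStep v w
    neighbours-sound {v} = [ rightOf-sound , [ upOf-sound , [ leftOf-sound , belowOf-sound ]′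
      ∘ ∈-++⁻ (leftOf v) ]′ ∘ ∈-++⁻ (upOf v) ]′ ∘ ∈-++⁻ (rightOf v)

    neighbours-complete : ∀ {v w} → GridStep v w → w ∈ neighbours v
    neighbours-complete (right {a} {b} e) =
      ∈-++⁺ˡ (∈-keepIf⁺ {d = fH (suc a) b ≟ᵇ true} e)
    neighbours-complete (up {a} {b} e) =
      ∈-++⁺ʳ (rightOf (a , b)) (∈-++⁺ˡ (∈-keepIf⁺ {d = fV a (suc b) ≟ᵇ true} e))
    neighbours-complete (left {a} {b} e) =
      ∈-++⁺ʳ (rightOf (suc a , b)) (∈-++⁺ʳ (upOf (suc a , b))
        (∈-++⁺ˡ (∈-keepIf⁺ {d = fH (suc a) b ≟ᵇ true} e)))
    neighbours-complete (down {a} {b} e) =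
      ∈-++⁺ʳ (rightOf (a , suc b)) (∈-++⁺ʳ (upOf (a , suc b)) (∈-++⁺ʳ (leftOf (a , suc b))
        (∈-keepIf⁺ {d = fV a (suc b) ≟ᵇ true} e)))

    module GridReach {T : ℕ × ℕ → Set} (T? : Decidable T) where
      open Reachability (≡-dec _≟ℕ_ _≟ℕ_) GridStep neighbours neighbours-sound neighbours-complete
        (λ (a , b) → (a <? n) ×-dec (b <? n)) T?
        (cartesianProduct (upTo n) (upTo n)) (λ (a<n , b<n) → ∈-cartesianProduct⁺ (∈-upTo⁺ a<n) (∈-upTo⁺ b<n))
        public

      reaches-constant : ConstantAlongEdges λ a b → reaches (a , b)
      reaches-constant =
        (λ a b a<m b<n e → true⇔true⇒≡ (reaches-backward (s≤s a<m , b<n) (left e))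
                                         (reaches-backward (m<n⇒m<1+n a<m , b<n) (right e))) ,
        (λ a b a<n b<m e → true⇔true⇒≡ (reaches-backward (a<n , s≤s b<m) (down e))
                                         (reaches-backward (a<n , m<n⇒m<1+n b<m) (up e)))

  GridPath : ℕ × ℕ → ℕ × ℕ → Set
  GridPath v w = ∃[ ws ] All InGrid ws × Linked GridStep ws × head ws ≡ just v × last ws ≡ just w

  walk⇒path : ∀ {T v} (ω : Walk GridStep InGrid T v) → GridPath v (Walk.end ω)
  walk⇒path {v = v} ω = v ∷ rest , inside , linked , refl , ends
    where open Walk ω

  true-constantAlongEdges : ConstantAlongEdges λ _ _ → true
  true-constantAlongEdges = (λ _ _ _ _ _ → refl) , (λ _ _ _ _ _ → refl)

  module _ (even : EvenDegrees) where

    BottomExit RightExit : ℕ × ℕ → Set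
    BottomExit (a , b) = b ≡ 0 × fV a 0 ≡ true
    RightExit  (a , b) = a ≡ m × fH n b ≡ true

    vertical-crossing : (∀ b → b < n → fH 0 b ≡ false) → (∀ b → b < n → fH n b ≡ false) →
      topFlux (λ _ _ → true) ≡ true →
      ∃[ a ] ∃[ a' ] fV a n ≡ true × fV a' 0 ≡ true × GridPath (a , m) (a' , 0)
    vertical-crossing left0 right0 odd =
      let a , _ , e = parity-true⇒∃ n (λ a → reaches (a , m) ∧ fV a n) topFlux-reaches
          r , top = ∧≡true⇒ e
          a' , bottom , path = exit (reaches⇒walk r)
      in a , a' , top , bottom , path
      where
        exit : ∀ {v} → Walk GridStep InGrid BottomExit v → ∃[ a' ] fV a' 0 ≡ true × GridPath v (a' , 0)
        exit ω with Walk.end ω | Walk.reached ω | walk⇒path ω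
        ... | a' , .0 | refl , e | path = a' , e , path

        open GridReach {BottomExit} (λ (a , b) → (b ≟ℕ 0) ×-dec (fV a 0 ≟ᵇ true))
        topFlux-reaches : topFlux (λ a b → reaches (a , b)) ≡ true
        topFlux-reaches = begin
          topFlux (λ a b → reaches (a , b))
            ≡⟨ sym (bottomFlux≡topFlux even _ reaches-constant left0 right0) ⟩
          bottomFlux (λ a b → reaches (a , b))
            ≡⟨ parity-cong n (λ a a<n → ∧-cong-guarded (fV a 0) λ e →
                 reaches-target (a<n , s≤s z≤n) (refl , e)) ⟩
          bottomFlux (λ _ _ → true)
            ≡⟨ bottomFlux≡topFlux even _ true-constantAlongEdges left0 right0 ⟩
          topFlux (λ _ _ → true)
            ≡⟨ odd ⟩
          true ∎

    horizontal-crossing : (∀ a → a < n → fV a 0 ≡ false) → (∀ a → a < n → fV a n ≡ false) →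
      leftFlux (λ _ _ → true) ≡ true →
      ∃[ b ] ∃[ b' ] fH 0 b ≡ true × fH n b' ≡ true × GridPath (0 , b) (m , b')
    horizontal-crossing bottom0 top0 odd =
      let b , _ , e = parity-true⇒∃ n (λ b → reaches (0 , b) ∧ fH 0 b) leftFlux-reaches
          r , left1 = ∧≡true⇒ e
          b' , right1 , path = exit (reaches⇒walk r)
      in b , b' , left1 , right1 , path
      where
        exit : ∀ {v} → Walk GridStep InGrid RightExit v → ∃[ b' ] fH n b' ≡ true × GridPath v (m , b')
        exit ω with Walk.end ω | Walk.reached ω | walk⇒path ω
        ... | .m , b' | refl , e | path = b' , e , path

        open GridReach {RightExit} (λ (a , b) → (a ≟ℕ m) ×-dec (fH n b ≟ᵇ true))
        leftFlux-reaches : leftFlux (λ a b → reaches (a , b)) ≡ true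
        leftFlux-reaches = begin
          leftFlux (λ a b → reaches (a , b))
            ≡⟨ leftFlux≡rightFlux even _ reaches-constant bottom0 top0 ⟩
          rightFlux (λ a b → reaches (a , b))
            ≡⟨ parity-cong n (λ b b<n → ∧-cong-guarded (fH n b) λ e →
                 reaches-target (≤-refl , b<n) (refl , e)) ⟩
          rightFlux (λ _ _ → true)
            ≡⟨ sym (leftFlux≡rightFlux even _ true-constantAlongEdges bottom0 top0) ⟩
          leftFlux (λ _ _ → true)
            ≡⟨ odd ⟩
          true ∎

_≟ᶜ_ : DecidableEquality Colour
green ≟ᶜ green = yes refl
green ≟ᶜ red   = no λ ()
red   ≟ᶜ green = no λ ()
red   ≟ᶜ red   = yes refl

VertexPattern : (N S E W : Colour) → Set
VertexPattern N S E W = (N ≡ S × E ≡ S × W ≡ S) ⊎ (N ≡ W × S ≡ E × N ≢ S) ⊎ (N ≡ E × S ≡ W × N ≢ S)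

-- p is the parity of a + b at the internal vertex (suc a , suc b); the four colours are cN, cS,
-- cE and cW there once odd (a + suc b) is rewritten to not p.
balanced⇒pattern : ∀ hW hE vS vN p → b2n hW + b2n (not hE) + b2n vS + b2n (not vN) ≡ 2 →
  VertexPattern (agree vN (not (not (not p)))) (agree vS (not (not p)))
                (agree hE (not (not p))) (agree hW (not p))
balanced⇒pattern true  true  true  true  true  _  = inj₂ (inj₁ (refl , refl , λ ()))
balanced⇒pattern true  true  true  true  false _  = inj₂ (inj₁ (refl , refl , λ ()))
balanced⇒pattern true  true  true  false _     ()
balanced⇒pattern true  true  false true  _     ()
balanced⇒pattern true  true  false false true  _  = inj₂ (inj₂ (refl , refl , λ ()))
balanced⇒pattern true  true  false false false _  = inj₂ (inj₂ (refl , refl , λ ()))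
balanced⇒pattern true  false true  true  _     ()
balanced⇒pattern true  false true  false _     ()
balanced⇒pattern true  false false true  true  _  = inj₁ (refl , refl , refl)
balanced⇒pattern true  false false true  false _  = inj₁ (refl , refl , refl)
balanced⇒pattern true  false false false _     ()
balanced⇒pattern false true  true  true  _     ()
balanced⇒pattern false true  true  false true  _  = inj₁ (refl , refl , refl)
balanced⇒pattern false true  true  false false _  = inj₁ (refl , refl , refl)
balanced⇒pattern false true  false true  _     ()
balanced⇒pattern false true  false false _     ()
balanced⇒pattern false false true  true  true  _  = inj₂ (inj₂ (refl , refl , λ ()))
balanced⇒pattern false false true  true  false _  = inj₂ (inj₂ (refl , refl , λ ()))
balanced⇒pattern false false true  false _     ()
balanced⇒pattern false false false true  _     ()
balanced⇒pattern false false false false true  _  = inj₂ (inj₁ (refl , refl , λ ()))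
balanced⇒pattern false false false false false _  = inj₂ (inj₁ (refl , refl , λ ()))

eulerian⇒pattern : ∀ {n τ} → Eulerian n τ → ∀ {a b} → a < n → b < n →
  VertexPattern (cN τ a b) (cS τ a b) (cE τ a b) (cW τ a b)
eulerian⇒pattern {τ = τ} eul {a} {b} a<n b<n rewrite +-suc a b =
  balanced⇒pattern (hor τ a (suc b)) (hor τ (suc a) (suc b)) (ver τ (suc a) b) (ver τ (suc a) (suc b))
    (odd (a + b)) (eul a b a<n b<n)

pattern-NS⇒E : ∀ {N S E W c} → VertexPattern N S E W → N ≡ c → S ≡ c → E ≡ c
pattern-NS⇒E (inj₁ (_ , E≡S , _))      _    S≡c  = trans E≡S S≡c
pattern-NS⇒E (inj₂ (inj₁ (_ , _ , N≢S))) refl refl = ⊥-elim (N≢S refl)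
pattern-NS⇒E (inj₂ (inj₂ (_ , _ , N≢S))) refl refl = ⊥-elim (N≢S refl)

pattern-EW⇒N : ∀ {N S E W c} → VertexPattern N S E W → E ≡ c → W ≡ c → N ≡ c
pattern-EW⇒N (inj₁ (N≡S , _ , W≡S))     _   W≡c = trans N≡S (trans (sym W≡S) W≡c)
pattern-EW⇒N (inj₂ (inj₁ (N≡W , _ , _))) _   W≡c = trans N≡W W≡c
pattern-EW⇒N (inj₂ (inj₂ (N≡E , _ , _))) E≡c _   = trans N≡E E≡c

is : Colour → Colour → Bool
is c X = does (X ≟ᶜ c)

-- The c-coloured edges at a vertex are none, all four, or the two edges cut off by an
-- L_τ-diagonal, across which k is constant.
corner-parity : ∀ c {N S E W} (kSW kSE kNW kNE : Bool) → VertexPattern N S E W →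
  (N ≡ W × S ≡ E × N ≢ S → kSW ≡ kNE) → (N ≡ E × S ≡ W × N ≢ S → kSE ≡ kNW) →
  ((is c W ∧ (kSW xor kNW)) xor (is c E ∧ (kSE xor kNE)))
    xor ((is c S ∧ (kSW xor kSE)) xor (is c N ∧ (kNW xor kNE))) ≡ false
corner-parity c {S = S} kSW kSE kNW kNE (inj₁ (refl , refl , refl)) _ _ with is c S
... | true  = trans (cong (_xor ((kSW xor kSE) xor (kNW xor kNE))) (xor-interchange kSW kNW kSE kNE))
                    (xor-same ((kSW xor kSE) xor (kNW xor kNE)))
... | false = refl
corner-parity c {N} {S} kSW kSE kNW kNE (inj₂ (inj₁ split@(refl , refl , _))) kSW≡kNE _
  rewrite kSW≡kNE split | xor-comm kSE kNE | xor-comm kNW kNE =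
  trans (cong (p xor_) (xor-comm (is c S ∧ (kNE xor kSE)) (is c N ∧ (kNE xor kNW)))) (xor-same p)
  where
    p : Bool
    p = (is c N ∧ (kNE xor kNW)) xor (is c S ∧ (kNE xor kSE))
corner-parity c {N} {S} kSW kSE kNW kNE (inj₂ (inj₂ split@(refl , refl , _))) _ kSE≡kNW
  rewrite kSE≡kNW split = xor-same ((is c S ∧ (kSW xor kNW)) xor (is c N ∧ (kNW xor kNE)))

is-sound : ∀ {c X} → is c X ≡ true → X ≡ c
is-sound {green} {green} _ = refl
is-sound {red}   {red}   _ = refl

is-other : ∀ {X c c'} → X ≡ c → c ≢ c' → is c' X ≡ false
is-other refl c≢c' = dec-false (_ ≟ᶜ _) c≢c'

is-green-xor-red : ∀ X d → (is green X ∧ d) xor (is red X ∧ d) ≡ d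
is-green-xor-red green d = xor-identityʳ d
is-green-xor-red red   d = refl

some-colour-odd : ∀ m (X : ℕ → Colour) (d : ℕ → Bool) → parity m d ≡ true →
  ∃[ c ] parity m (λ i → is c (X i) ∧ d i) ≡ true
some-colour-odd m X d odd with parity m (λ i → is green (X i) ∧ d i) in green-odd
... | true  = green , green-odd
... | false = red , (begin
  parity m (λ i → is red (X i) ∧ d i)
    ≡⟨ cong (_xor parity m (λ i → is red (X i) ∧ d i)) (sym green-odd) ⟩
  parity m (λ i → is green (X i) ∧ d i) xor parity m (λ i → is red (X i) ∧ d i)
    ≡⟨ sym (parity-xor m (λ i → is green (X i) ∧ d i) (λ i → is red (X i) ∧ d i)) ⟩
  parity m (λ i → (is green (X i) ∧ d i) xor (is red (X i) ∧ d i))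
    ≡⟨ parity-cong m (λ i _ → is-green-xor-red (X i) (d i)) ⟩
  parity m d
    ≡⟨ odd ⟩
  true ∎)
  where open ≡-Reasoning

ClosedUnderL : ℕ → Orientation → (Vertex → Bool) → Set
ClosedUnderL n τ k = ∀ {a b} → a < n → b < n →
  (NEinL τ a b → k (a , b) ≡ k (suc a , suc b)) × (NWinL τ a b → k (suc a , b) ≡ k (a , suc b))

-- Grid vertex (a , b) is the internal vertex (suc a , suc b) of Λ_n: crossingH τ k c x b marks
-- the edge h x (suc b), between the L-vertices (x , b) and (x , suc b), and crossingV τ k c a y
-- the edge v (suc a) y, between (a , y) and (suc a , y).
crossingH crossingV : Orientation → (Vertex → Bool) → Colour → ℕ → ℕ → Bool
crossingH τ k c x b = is c (colH τ x (suc b)) ∧ (k (x , b) xor k (x , suc b))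
crossingV τ k c a y = is c (colV τ (suc a) y) ∧ (k (a , y) xor k (suc a , y))

crossingH-colour : ∀ {τ k c x b} → crossingH τ k c x b ≡ true → colH τ x (suc b) ≡ c
crossingH-colour e = is-sound (proj₁ (∧≡true⇒ e))

crossingV-colour : ∀ {τ k c a y} → crossingV τ k c a y ≡ true → colV τ (suc a) y ≡ c
crossingV-colour e = is-sound (proj₁ (∧≡true⇒ e))

crossings-even : ∀ {m τ k} → Eulerian (suc m) τ → ClosedUnderL (suc m) τ k → ∀ c →
  Grid.EvenDegrees m (crossingH τ k c) (crossingV τ k c)
crossings-even {τ = τ} {k} eul closed c a b a<n b<n =
  corner-parity c (k (a , b)) (k (suc a , b)) (k (a , suc b)) (k (suc a , suc b))
    (eulerian⇒pattern {τ = τ} eul a<n b<n) (proj₁ (closed a<n b<n)) (proj₂ (closed a<n b<n))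

crossingH-equal : ∀ {τ k c x b} → k (x , b) ≡ k (x , suc b) → crossingH τ k c x b ≡ false
crossingH-equal {τ} {k} {c} {x} {b} same = trans
  (cong (is c (colH τ x (suc b)) ∧_) (trans (cong (_xor k (x , suc b)) same) (xor-same (k (x , suc b)))))
  (∧-zeroʳ _)

crossingV-equal : ∀ {τ k c a y} → k (a , y) ≡ k (suc a , y) → crossingV τ k c a y ≡ false
crossingV-equal {τ} {k} {c} {a} {y} same = trans
  (cong (is c (colV τ (suc a) y) ∧_) (trans (cong (_xor k (suc a , y)) same) (xor-same (k (suc a , y)))))
  (∧-zeroʳ _)

shift : Vertex → Vertex
shift (a , b) = suc a , suc b

module _ {m : ℕ} {τ : Orientation} {c : Colour} {fH fV : ℕ → ℕ → Bool}
  (colourH : ∀ {a b} → fH a b ≡ true → colH τ a (suc b) ≡ c)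
  (colourV : ∀ {a b} → fV a b ≡ true → colV τ (suc a) b ≡ c) where

  open Grid m fH fV using (GridStep; right; left; up; down; InGrid; GridPath)
  open LoopErasure (≡-dec _≟ℕ_ _≟ℕ_) (Step τ c) (Internal (suc m)) using (simplify)

  lift-step : ∀ {v w} → GridStep v w → Step τ c (shift v) (shift w)
  lift-step (right e) = right (colourH e)
  lift-step (left e)  = left (colourH e)
  lift-step (up e)    = up (colourV e)
  lift-step (down e)  = down (colourV e)

  lift-inside : ∀ {v} → InGrid v → Internal (suc m) (shift v)
  lift-inside (a<n , b<n) = (s≤s z≤n , a<n) , (s≤s z≤n , b<n)

  lift-path : ∀ {v w} → GridPath v w →
    ∃[ ps ] MonoPath (suc m) τ c ps × head ps ≡ just (shift v) × last ps ≡ just (shift w)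
  lift-path (ws , inside , linked , hd , lt) =
    simplify (map shift ws) (All.map⁺ (All.map lift-inside inside)) (Linked.map⁺ (Linked.map lift-step linked))
      (trans (head-map {f = shift} ws) (cong (Maybe.map shift) hd)) (trans (last-map shift ws) (cong (Maybe.map shift) lt))

  lift-vertical : (∃[ a ] ∃[ a' ] fV a (suc m) ≡ true × fV a' 0 ≡ true × GridPath (a , m) (a' , 0)) →
    VBridge (suc m) τ c
  lift-vertical (a , a' , top , bottom , grid-path) =
    let ps , path , hd , lt = lift-path grid-path
    in ps , suc a , suc a' , path , hd , colourV top , lt , colourV bottom

  lift-horizontal : (∃[ b ] ∃[ b' ] fH 0 b ≡ true × fH (suc m) b' ≡ true × GridPath (0 , b) (m , b')) →
    HBridge (suc m) τ c
  lift-horizontal (b , b' , left1 , right1 , grid-path) =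
    let ps , path , hd , lt = lift-path grid-path
    in ps , suc b , suc b' , path , hd , colourH left1 , lt , colourH right1

module _ {m : ℕ} {τ : Orientation} (eul : Eulerian (suc m) τ)
  {k : Vertex → Bool} (closed : ClosedUnderL (suc m) τ k) where

  private
    n : ℕ
    n = suc m

  vertical-bridge : (∀ y → y ≤ n → k (0 , y) ≡ false) → (∀ y → y ≤ n → k (n , y) ≡ true) →
    ∃[ c ] VBridge n τ c
  vertical-bridge outside inside = map₂ bridge
    (some-colour-odd n (λ a → colV τ (suc a) n) (λ a → k (a , n) xor k (suc a , n))
      (trans (parity-telescope n λ a → k (a , n)) (cong₂ _xor_ (outside n ≤-refl) (inside n ≤-refl))))
    where
      bridge : ∀ {c} → parity n (λ a → crossingV τ k c a n) ≡ true → VBridge n τ c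
      bridge {c} odd = lift-vertical (crossingH-colour {τ} {k} {c}) (crossingV-colour {τ} {k} {c})
        (Grid.vertical-crossing m (crossingH τ k c) (crossingV τ k c) (crossings-even {τ = τ} {k} eul closed c)
          (λ b b<n → crossingH-equal {τ} {k} (trans (outside b (<⇒≤ b<n)) (sym (outside (suc b) b<n))))
          (λ b b<n → crossingH-equal {τ} {k} (trans (inside b (<⇒≤ b<n)) (sym (inside (suc b) b<n))))
          odd)

data Dir : Set where
  north east south west : Dir

opposite : Dir → Dir
opposite north = south
opposite east  = west
opposite south = north
opposite west  = east

edgeColour : Orientation → Vertex → Dir → Colour
edgeColour τ (x , y) north = colV τ x y
edgeColour τ (x , y) east  = colH τ x y
edgeColour τ (x , y) south = colV τ x (y ∸ 1)
edgeColour τ (x , y) west  = colH τ (x ∸ 1) y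

-- The L-vertex to the right of a vertical edge or above a horizontal one, so that it is the
-- same when the edge is seen from either endpoint.
flank : Vertex → Dir → Vertex
flank (x , y) north = x , y
flank (x , y) east  = x , y
flank (x , y) south = x , y ∸ 1
flank (x , y) west  = x ∸ 1 , y

step-direction : ∀ {τ c u w} → Step τ c u w →
  ∃[ d ] edgeColour τ u d ≡ c × edgeColour τ w (opposite d) ≡ c × flank u d ≡ flank w (opposite d)
step-direction (right e) = east  , e , e , refl
step-direction (left e)  = west  , e , e , refl
step-direction (up e)    = north , e , e , refl
step-direction (down e)  = south , e , e , refl

module _ {n : ℕ} {τ : Orientation} (eul : Eulerian n τ) {c : Colour} (s : Vertex → Bool)
  (flatH : ∀ {x y} → colH τ x (suc y) ≡ c → s (x , y) ≡ s (x , suc y))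
  (flatV : ∀ {x y} → x < n → y ≤ n → colV τ (suc x) y ≡ c → s (x , y) ≡ s (suc x , y)) where

  flanks-agree : ∀ {u} d₁ d₂ → Internal n u → edgeColour τ u d₁ ≡ c → edgeColour τ u d₂ ≡ c →
    s (flank u d₁) ≡ s (flank u d₂)
  flanks-agree {suc a , suc b} d₁ d₂ ((_ , a<n) , (_ , b<n)) = agree-at d₁ d₂
    where
      pat : VertexPattern (cN τ a b) (cS τ a b) (cE τ a b) (cW τ a b)
      pat = eulerian⇒pattern {τ = τ} eul a<n b<n
      flatN : cN τ a b ≡ c → s (a , suc b) ≡ s (suc a , suc b)
      flatN = flatV a<n b<n
      flatE : cE τ a b ≡ c → s (suc a , b) ≡ s (suc a , suc b)
      flatE = flatH
      flatS : cS τ a b ≡ c → s (a , b) ≡ s (suc a , b)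
      flatS = flatV a<n (<⇒≤ b<n)
      flatW : cW τ a b ≡ c → s (a , b) ≡ s (a , suc b)
      flatW = flatH
      agree-at : ∀ d₁ d₂ → edgeColour τ (suc a , suc b) d₁ ≡ c → edgeColour τ (suc a , suc b) d₂ ≡ c →
        s (flank (suc a , suc b) d₁) ≡ s (flank (suc a , suc b) d₂)
      agree-at north north _  _  = refl
      agree-at north east  _  _  = refl
      agree-at north south cn cs = sym (flatE (pattern-NS⇒E pat cn cs))
      agree-at north west  cn _  = sym (flatN cn)
      agree-at east  north _  _  = refl
      agree-at east  east  _  _  = refl
      agree-at east  south ce _  = sym (flatE ce)
      agree-at east  west  ce cw = sym (flatN (pattern-EW⇒N pat ce cw))
      agree-at south north cs cn = flatE (pattern-NS⇒E pat cn cs)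
      agree-at south east  _  ce = flatE ce
      agree-at south south _  _  = refl
      agree-at south west  cs cw = trans (sym (flatS cs)) (flatW cw)
      agree-at west  north _  cn = flatN cn
      agree-at west  east  cw ce = flatN (pattern-EW⇒N pat ce cw)
      agree-at west  south cw cs = trans (sym (flatW cw)) (flatS cs)
      agree-at west  west  _  _  = refl

  path-flanks-agree : ∀ {u z} d d' ps → All (Internal n) (u ∷ ps) → Linked (Step τ c) (u ∷ ps) →
    last (u ∷ ps) ≡ just z → edgeColour τ u d ≡ c → edgeColour τ z d' ≡ c → s (flank u d) ≡ s (flank z d')
  path-flanks-agree d d' [] (i ∷ []) _ refl cu cz = flanks-agree d d' i cu cz
  path-flanks-agree d d' (w ∷ ps) (i ∷ is) (st ∷ l) lt cu cz with step-direction st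
  ... | d₁ , cu₁ , cw₁ , same = trans (flanks-agree d d₁ i cu cu₁)
                                  (trans (cong s same) (path-flanks-agree (opposite d₁) d' ps is l lt cw₁ cz))

module _ {m : ℕ} {τ : Orientation} (eul : Eulerian (suc m) τ)
  {k : Vertex → Bool} (closed : ClosedUnderL (suc m) τ k)
  (bottom-in : ∀ x → x ≤ suc m → k (x , 0) ≡ true) (top-out : ∀ x → x ≤ suc m → k (x , suc m) ≡ false) where

  private
    n : ℕ
    n = suc m

    bottom0 : ∀ {c} a → a < n → crossingV τ k c a 0 ≡ false
    bottom0 a a<n = crossingV-equal {τ} {k} (trans (bottom-in a (<⇒≤ a<n)) (sym (bottom-in (suc a) a<n)))

    top0 : ∀ {c} a → a < n → crossingV τ k c a n ≡ false
    top0 a a<n = crossingV-equal {τ} {k} (trans (top-out a (<⇒≤ a<n)) (sym (top-out (suc a) a<n)))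

  left-odd : ∃[ c ] parity n (crossingH τ k c 0) ≡ true
  left-odd = some-colour-odd n (λ b → colH τ 0 (suc b)) (λ b → k (0 , b) xor k (0 , suc b))
    (trans (parity-telescope n λ b → k (0 , b)) (cong₂ _xor_ (bottom-in 0 z≤n) (top-out 0 z≤n)))

  horizontal-bridge : ∀ {c} → parity n (crossingH τ k c 0) ≡ true → HBridge n τ c
  horizontal-bridge {c} odd = lift-horizontal (crossingH-colour {τ} {k} {c}) (crossingV-colour {τ} {k} {c})
    (Grid.horizontal-crossing m (crossingH τ k c) (crossingV τ k c) (crossings-even {τ = τ} {k} eul closed c)
      bottom0 top0 odd)

  no-vertical-bridge : ∀ {c c'} → parity n (crossingH τ k c' 0) ≡ true → c ≢ c' → ¬ VBridge n τ c
  no-vertical-bridge {c} {c'} odd c≢c'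
    (u ∷ ps , i , i' , (insd@(((_ , i≤n) , _) ∷ _) , linked , _) , refl , top , lt , bottom) = true≢false (trans (sym (potential-top even bottom0 top0 odd i i≤n))
        (path-flanks-agree eul (λ (x , y) → potential x y) flatH flatV north south ps insd linked lt top bottom))
    where
      open Grid m (crossingH τ k c') (crossingV τ k c') using (potential; potential-step-right; potential-top)
      even : Grid.EvenDegrees m (crossingH τ k c') (crossingV τ k c')
      even = crossings-even {τ = τ} {k} eul closed c'
      flatH : ∀ {x y} → colH τ x (suc y) ≡ c → potential x y ≡ potential x (suc y)
      flatH {x} {y} e = sym (trans (cong (λ z → potential x y xor (z ∧ _)) (is-other e c≢c')) (xor-identityʳ _))
      flatV : ∀ {x y} → x < n → y ≤ n → colV τ (suc x) y ≡ c → potential x y ≡ potential (suc x) y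
      flatV {x} {y} x<n y≤n e =
        sym (xor≡false⇒≡ (trans (potential-step-right even bottom0 x y x<n y≤n) (cong (_∧ _) (is-other e c≢c'))))

module LGraph (n : ℕ) (τ : Orientation) where

  NE? : ∀ a b → Dec (a < n × b < n × NEinL τ a b)
  NE? a b = (a <? n) ×-dec (b <? n) ×-dec
            (cN τ a b ≟ᶜ cW τ a b) ×-dec (cS τ a b ≟ᶜ cE τ a b) ×-dec ¬? (cN τ a b ≟ᶜ cS τ a b)
  NW? : ∀ a b → Dec (a < n × b < n × NWinL τ a b)
  NW? a b = (a <? n) ×-dec (b <? n) ×-dec
            (cN τ a b ≟ᶜ cE τ a b) ×-dec (cS τ a b ≟ᶜ cW τ a b) ×-dec ¬? (cN τ a b ≟ᶜ cS τ a b)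

  private
    upRight downLeft upLeft downRight neighbours : Vertex → List Vertex
    upRight   (x , y)         = keepIf (NE? x y) (suc x , suc y)
    downLeft  (suc a , suc b) = keepIf (NE? a b) (a , b)
    downLeft  (zero , _)      = []
    downLeft  (suc _ , zero)  = []
    upLeft    (suc a , y)     = keepIf (NW? a y) (a , suc y)
    upLeft    (zero , _)      = []
    downRight (x , suc b)     = keepIf (NW? x b) (suc x , b)
    downRight (_ , zero)      = []
    neighbours v = upRight v ++ downLeft v ++ upLeft v ++ downRight v

    upRight-sound : ∀ {v w} → w ∈ upRight v → LStep n τ v w
    upRight-sound w∈ with ∈-keepIf⁻ w∈
    ... | (a<n , b<n , p) , refl = ne a<n b<n p

    downLeft-sound : ∀ {v w} → w ∈ downLeft v → LStep n τ v w
    downLeft-sound {suc a , suc b} w∈ with ∈-keepIf⁻ w∈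
    ... | (a<n , b<n , p) , refl = ne' a<n b<n p

    upLeft-sound : ∀ {v w} → w ∈ upLeft v → LStep n τ v w
    upLeft-sound {suc a , b} w∈ with ∈-keepIf⁻ w∈
    ... | (a<n , b<n , p) , refl = nw a<n b<n p

    downRight-sound : ∀ {v w} → w ∈ downRight v → LStep n τ v w
    downRight-sound {a , suc b} w∈ with ∈-keepIf⁻ w∈
    ... | (a<n , b<n , p) , refl = nw' a<n b<n p

    neighbours-sound : ∀ {v w} → w ∈ neighbours v → LStep n τ v w
    neighbours-sound {v} = [ upRight-sound , [ downLeft-sound , [ upLeft-sound , downRight-sound ]′
      ∘ ∈-++⁻ (upLeft v) ]′ ∘ ∈-++⁻ (downLeft v) ]′ ∘ ∈-++⁻ (upRight v)

    neighbours-complete : ∀ {v w} → LStep n τ v w → w ∈ neighbours v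
    neighbours-complete (ne {a} {b} a<n b<n p) =
      ∈-++⁺ˡ (∈-keepIf⁺ {d = NE? a b} (a<n , b<n , p))
    neighbours-complete (ne' {a} {b} a<n b<n p) =
      ∈-++⁺ʳ (upRight (suc a , suc b)) (∈-++⁺ˡ (∈-keepIf⁺ {d = NE? a b} (a<n , b<n , p)))
    neighbours-complete (nw {a} {b} a<n b<n p) =
      ∈-++⁺ʳ (upRight (suc a , b)) (∈-++⁺ʳ (downLeft (suc a , b))
        (∈-++⁺ˡ (∈-keepIf⁺ {d = NW? a b} (a<n , b<n , p))))
    neighbours-complete (nw' {a} {b} a<n b<n p) =
      ∈-++⁺ʳ (upRight (a , suc b)) (∈-++⁺ʳ (downLeft (a , suc b)) (∈-++⁺ʳ (upLeft (a , suc b))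
        (∈-keepIf⁺ {d = NW? a b} (a<n , b<n , p))))

  module LReach {T : Vertex → Set} (T? : Decidable T) where
    open Reachability (≡-dec _≟ℕ_ _≟ℕ_) (LStep n τ) neighbours neighbours-sound neighbours-complete
      (λ (x , y) → (x ≤? n) ×-dec (y ≤? n)) T?
      (cartesianProduct (upTo (suc n)) (upTo (suc n)))
      (λ (x≤n , y≤n) → ∈-cartesianProduct⁺ (∈-upTo⁺ (s≤s x≤n)) (∈-upTo⁺ (s≤s y≤n)))
      public
    open LoopErasure (≡-dec _≟ℕ_ _≟ℕ_) (LStep n τ) (LVertex n) using (simplify)

    reaches-closed : ClosedUnderL n τ reaches
    reaches-closed a<n b<n =
      (λ p → true⇔true⇒≡ (reaches-backward (a<n , b<n) (ne' a<n b<n p))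
                           (reaches-backward (<⇒≤ a<n , <⇒≤ b<n) (ne a<n b<n p))) ,
      (λ p → true⇔true⇒≡ (reaches-backward (<⇒≤ a<n , b<n) (nw' a<n b<n p))
                           (reaches-backward (a<n , <⇒≤ b<n) (nw a<n b<n p)))

    fault-path : ∀ {v} → reaches v ≡ true →
      ∃[ qs ] LPath n τ qs × head qs ≡ just v × ∃[ t ] last qs ≡ just t × T t
    fault-path {v} r =
      let qs , path , hd , lt = simplify (v ∷ rest) inside linked refl ends in qs , path , hd , end , lt , reached
      where open Walk (reaches⇒walk {v} r)

module Faults (n : ℕ) (τ : Orientation) where

  open LGraph n τ using (module LReach)

  module ToRight  = LReach {λ (x , _) → x ≡ n} (λ (x , _) → x ≟ℕ n)
  module ToBottom = LReach {λ (_ , y) → y ≡ 0} (λ (_ , y) → y ≟ℕ 0)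

  horizontal-fault : ∀ {y} → ToRight.reaches (0 , y) ≡ true → HFault n τ
  horizontal-fault {y} r with ToRight.fault-path r
  ... | qs , path , hd , (.n , y') , lt , refl = qs , y , y' , path , hd , lt

  vertical-fault : ∀ {x} → ToBottom.reaches (x , n) ≡ true → VFault n τ
  vertical-fault {x} r with ToBottom.fault-path r
  ... | qs , path , hd , (x' , .0) , lt , refl = qs , x , x' , path , hd , lt

no-fault⇒cross : ∀ {n τ} → Eulerian n τ →
  (∀ y → y ≤ n → Faults.ToRight.reaches n τ (0 , y) ≡ false) →
  (∀ x → x ≤ n → Faults.ToBottom.reaches n τ (x , n) ≡ false) →
  ∃[ c ] Cross n τ c
no-fault⇒cross {zero} {τ} _ outside _ =
  ⊥-elim (true≢false (trans (sym (ToRight.reaches-target (z≤n , z≤n) refl)) (outside 0 z≤n)))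
  where open Faults zero τ
no-fault⇒cross {suc m} {τ} eul outside top-out =
  meet (vertical-bridge {τ = τ} eul {ToRight.reaches} ToRight.reaches-closed outside
                        λ y y≤n → ToRight.reaches-target (≤-refl , y≤n) refl)
       (left-odd {τ = τ} eul {ToBottom.reaches} ToBottom.reaches-closed bottom-in top-out)
  where
    open Faults (suc m) τ
    bottom-in : ∀ x → x ≤ suc m → ToBottom.reaches (x , 0) ≡ true
    bottom-in x x≤n = ToBottom.reaches-target (x≤n , z≤n) refl
    meet : ∃[ c ] VBridge (suc m) τ c →
      ∃[ c' ] parity (suc m) (crossingH τ ToBottom.reaches c' 0) ≡ true → ∃[ c ] Cross (suc m) τ c
    meet (c , vertical) (c' , odd) with c ≟ᶜ c'
    ... | yes refl =
      c , horizontal-bridge {τ = τ} eul ToBottom.reaches-closed bottom-in top-out odd , vertical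
    ... | no c≢c' =
      ⊥-elim (no-vertical-bridge {τ = τ} eul ToBottom.reaches-closed bottom-in top-out odd c≢c' vertical)

mainTheorem3 : (n : ℕ) (τ : Orientation) → Eulerian n τ →
    ¬ Cross n τ green × ¬ Cross n τ red →
    HFault n τ ⊎ VFault n τ
mainTheorem3 n τ eul (¬green , ¬red)
  with bounded-search (λ y → Faults.ToRight.reaches n τ (0 , y)) n
     | bounded-search (λ x → Faults.ToBottom.reaches n τ (x , n)) n
... | inj₁ (y , _ , r) | _                = inj₁ (Faults.horizontal-fault n τ {y} r)
... | inj₂ _           | inj₁ (x , _ , r) = inj₂ (Faults.vertical-fault n τ {x} r)
... | inj₂ outside     | inj₂ top-out with no-fault⇒cross eul outside top-out
...   | green , cross = ⊥-elim (¬green cross)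
...   | red   , cross = ⊥-elim (¬red cross)
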